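{- Let $n\ge k\ge 2$ be integers. For every nonnegative integer $m$ with $m < \frac{n^2}{2(k-1)} - \frac{n}{2}$, the coefficient of $t^m$ in $P_{n,k}(t)$ is $0$.
   Context: $[n]=\{1,\dots,n\}$; $\binom{S}{j}$ is the set of $j$-element subsets of $S$. Let $\mathcal{A}$ be the set of assignments $\mathfrak{g}$ which associate to each $S \in \binom{[n]}{k}$ a finite simple undirected graph $\mathfrak{g}_S$ on vertex set $S$ which is neither the complete graph nor the empty graph on $S$. For $\mathfrak{g}\in\mathcal{A}$, let $\mathrm{Edges}(\mathfrak{g}) := \bigcup_{S} \mathbf{E}(\mathfrak{g}_S) \subseteq \binom{[n]}{2}$ and $\mathrm{sign}(\mathfrak{g}) := \prod_{S} (-1)^{|\mathbf{E}(\mathfrak{g}_S)|}$. Define $P_{n,k}(t) := \sum_{\mathfrak{g}\in\mathcal{A}} \mathrm{sign}(\mathfrak{g})\, t^{|\mathrm{Edges}(\mathfrak{g})|} \in \mathbb{Z}[t]$. -}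

module Defs where

open import Data.Bool using (Bool; true; false; _∧_; not; if_then_else_)
open import Data.Nat using (ℕ; zero; suc; _<ᵇ_; _≡ᵇ_)
open import Data.Fin using (Fin; toℕ)
open import Data.Fin.Subset using (Subset; ∣_∣)
open import Data.Vec using (Vec; []; _∷_; lookup)
open import Data.List using (List; []; _∷_; [_]; map; _++_; concatMap; filterᵇ; length; foldr; null; allFin)
open import Data.Bool.ListAction using (any)
open import Data.Product using (_×_; _,_)
open import Data.Integer using (ℤ; 0ℤ; 1ℤ; -_; _+_)

-- an (unordered) pair {i,j} of [n] is represented as (i , j) with i < j
Edge : ℕ → Set
Edge n = Fin n × Fin n

allEdges : (n : ℕ) → List (Edge n)
allEdges n = concatMap (λ i → concatMap (λ j → if toℕ i <ᵇ toℕ j then [ (i , j) ] else []) (allFin n)) (allFin n)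

edgeEqᵇ : {n : ℕ} → Edge n → Edge n → Bool
edgeEqᵇ (i , j) (i' , j') = (toℕ i ≡ᵇ toℕ i') ∧ (toℕ j ≡ᵇ toℕ j')

allSubsets : (n : ℕ) → List (Subset n)
allSubsets zero = [ [] ]
allSubsets (suc n) = map (true ∷_) (allSubsets n) ++ map (false ∷_) (allSubsets n)

kSubsets : (n k : ℕ) → List (Subset n)
kSubsets n k = filterᵇ (λ S → ∣ S ∣ ≡ᵇ k) (allSubsets n)

edgesIn : {n : ℕ} → Subset n → List (Edge n)
edgesIn {n} S = filterᵇ (λ { (i , j) → lookup S i ∧ lookup S j }) (allEdges n)

sublists : {A : Set} → List A → List (List A)
sublists [] = [ [] ]
sublists (x ∷ xs) = map (x ∷_) (sublists xs) ++ sublists xs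

-- graphs on vertex set S, given by their edge sets ⊆ binom(S,2),
-- which are neither empty nor complete
graphsOn : {n : ℕ} → Subset n → List (List (Edge n))
graphsOn S = filterᵇ (λ G → not (null G) ∧ not (length G ≡ᵇ length (edgesIn S))) (sublists (edgesIn S))

choices : {A : Set} → List (List A) → List (List A)
choices [] = [ [] ]
choices (xs ∷ xss) = concatMap (λ x → map (x ∷_) (choices xss)) xs

-- the set 𝒜: an assignment is a list of graphs, the i-th one being 𝔤_S
-- for the i-th k-subset S in kSubsets n k
Assignment : ℕ → Set
Assignment n = List (List (Edge n))

assignments : (n k : ℕ) → List (Assignment n)
assignments n k = choices (map graphsOn (kSubsets n k))

numEdges : {n : ℕ} → Assignment n → ℕ
numEdges {n} g = length (filterᵇ (λ e → any (λ G → any (edgeEqᵇ e) G) g) (allEdges n))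

negOnePow : ℕ → ℤ
negOnePow zero = 1ℤ
negOnePow (suc k) = - negOnePow k

sumℤ : List ℤ → ℤ
sumℤ = foldr _+_ 0ℤ

sign : {n : ℕ} → Assignment n → ℤ
sign g = negOnePow (foldr (λ G acc → length G Data.Nat.+ acc) 0 g)

coeffP : (n k m : ℕ) → ℤ
coeffP n k m = sumℤ (map (λ g → if numEdges g ≡ᵇ m then sign g else 0ℤ) (assignments n k))

{-# OPTIONS --safe #-}
module Submission where

-- Let H be the graph on [n] with edge set Edges(𝔤). Every k-subset S carries the
-- graph 𝔤_S, which has an edge, so H has no independent set of size k. The
-- complement form of Turán's theorem then gives n² ≤ (k-1)(2|Edges(𝔤)| + n):
-- delete a vertex v of minimum degree d together with its neighbours; what is left
-- has no independent set of size k-1, each deleted vertex had degree ≥ d, so the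
-- degree sum drops by at least (d+1)d, and x² ≤ a w ⇒ (x+y)² ≤ (a+1)(w+y²) closes
-- the induction on k. Hence no assignment has m edges when m is below the bound,
-- and every term of the coefficient vanishes.

open import Defs
open import Data.Nat using (ℕ; _+_; _*_; _∸_; _≤_; _<_)
open import Data.Integer using (0ℤ)
open import Relation.Binary.PropositionalEquality using (_≡_)

open import Data.Bool using (Bool; true; false; _∧_; _∨_; not; T; T?; if_then_else_)
open import Data.Bool.ListAction using (any)
open import Data.Bool.Properties using (T-≡; T-∧; T-∨; ∨-comm)
open import Data.Empty using (⊥-elim)
open import Data.Fin using (Fin; zero; suc; toℕ)
open import Data.Fin.Properties using (_≟_; any?)
import Data.Fin.Subset as Subset
open import Data.Integer using (ℤ)
open import Data.List using (List; []; _∷_; [_]; _++_; map; concatMap; filterᵇ; length; null; tabulate; allFin)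
open import Data.List.Extrema.Nat using (argmin; argmin-all; f[argmin]≤f[xs])
open import Data.List.Membership.Propositional using (_∈_; find; lose)
open import Data.List.Membership.Propositional.Properties
  using (∈-concatMap⁻; ∈-map⁺; ∈-map⁻; ∈-++⁻; ∈-++⁺ˡ; ∈-++⁺ʳ; ∈-filter⁺; ∈-filter⁻; ∈-allFin)
open import Data.List.Properties using (filter-++; length-++)
open import Data.List.Relation.Unary.All using () renaming (lookup to All-lookup)
open import Data.List.Relation.Unary.All.Properties using (all-filter)
open import Data.List.Relation.Unary.Any using (here; there)
open import Data.List.Relation.Unary.Any.Properties using (any⁺)
open import Data.Nat using (zero; suc; z≤n; _<ᵇ_; _≡ᵇ_)
open import Data.Nat.Properties hiding (_≟_)
open import Algebra.Properties.Semiring.Sum +-*-semiring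
  using (sum; sum-syntax; sum-cong-≗; sum-replicate-zero; ∑-distrib-+; ∑-comm; *-distribʳ-sum)
open import Data.Nat.Tactic.RingSolver using (solve-∀; solve)
open import Data.Product using (∃; ∃₂; _×_; _,_; proj₁; proj₂)
open import Data.Sum using (inj₁; inj₂; [_,_]′)
import Data.Vec as Vec
open import Data.Vec.Properties using (lookup∘tabulate)
open import Function using (_∘_; _$_; id; Equivalence)
open import Relation.Binary.PropositionalEquality
  using (refl; sym; trans; cong; cong₂; subst; subst₂; module ≡-Reasoning)
open import Relation.Nullary using (¬_; does; yes; no; contradiction)

open Equivalence using (to; from)

private
  variable
    n : ℕ
    A B : Set

private
  2*m*n≤m*m+n*n-ordered : ∀ {m n} → m ≤ n → 2 * (m * n) ≤ m * m + n * n
  2*m*n≤m*m+n*n-ordered {m} m≤n with m≤n⇒∃[o]m+o≡n m≤n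
  ... | r , refl = subst (2 * (m * (m + r)) ≤_) (square-gap m r) (m≤m+n _ (r * r))
    where
    square-gap : ∀ m r → 2 * (m * (m + r)) + r * r ≡ m * m + (m + r) * (m + r)
    square-gap = solve-∀

2*m*n≤m*m+n*n : ∀ m n → 2 * (m * n) ≤ m * m + n * n
2*m*n≤m*m+n*n m n with ≤-total m n
... | inj₁ m≤n = 2*m*n≤m*m+n*n-ordered m≤n
... | inj₂ n≤m = subst₂ _≤_ (cong (2 *_) (*-comm n m)) (+-comm (n * n) (m * m)) (2*m*n≤m*m+n*n-ordered n≤m)

x²≤a*w⇒[x+y]²≤[1+a]*[w+y²] : ∀ a x y w → x * x ≤ a * w → (x + y) * (x + y) ≤ suc a * (w + y * y)
x²≤a*w⇒[x+y]²≤[1+a]*[w+y²] zero zero y w _ = ≤-trans (m≤n+m (y * y) w) (m≤m+n _ 0)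
x²≤a*w⇒[x+y]²≤[1+a]*[w+y²] (suc b) x y w x²≤aw = begin
    (x + y) * (x + y)                         ≡⟨ solve (x ∷ y ∷ []) ⟩
    x * x + 2 * (x * y) + y * y               ≤⟨ +-monoˡ-≤ (y * y) (+-mono-≤ x²≤aw cross) ⟩
    suc b * w + (w + suc b * (y * y)) + y * y ≡⟨ solve (b ∷ w ∷ y ∷ []) ⟩
    suc (suc b) * (w + y * y)                 ∎
  where
  open ≤-Reasoning
  cross : 2 * (x * y) ≤ w + suc b * (y * y)
  cross = *-cancelˡ-≤ (suc b) $ begin
    suc b * (2 * (x * y))                     ≡⟨ solve (b ∷ x ∷ y ∷ []) ⟩
    2 * (x * (suc b * y))                     ≤⟨ 2*m*n≤m*m+n*n x (suc b * y) ⟩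
    x * x + suc b * y * (suc b * y)           ≤⟨ +-monoˡ-≤ _ x²≤aw ⟩
    suc b * w + suc b * y * (suc b * y)       ≡⟨ solve (b ∷ w ∷ y ∷ []) ⟩
    suc b * (w + suc b * (y * y))             ∎

T-not⇒¬T : ∀ {b} → T (not b) → ¬ T b
T-not⇒¬T {false} _ ()

𝟙 : Bool → ℕ
𝟙 false = 0
𝟙 true  = 1

𝟙-split : ∀ b c → 𝟙 b ≡ 𝟙 (b ∧ not c) + 𝟙 (b ∧ c)
𝟙-split false _     = refl
𝟙-split true  false = refl
𝟙-split true  true  = refl

𝟙-∨ : ∀ {b c} → ¬ (T b × T c) → 𝟙 (b ∨ c) ≡ 𝟙 b + 𝟙 c
𝟙-∨ {false}         _        = refl
𝟙-∨ {true}  {false} _        = refl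
𝟙-∨ {true}  {true}  disjoint = contradiction _ disjoint

𝟙-mono : ∀ {b c} → (T b → T c) → 𝟙 b ≤ 𝟙 c
𝟙-mono {false}         _   = z≤n
𝟙-mono {true}  {true}  _   = ≤-refl
𝟙-mono {true}  {false} b⇒c = ⊥-elim (b⇒c _)

𝟙*-monoʳ-≤ : ∀ b {x y} → (T b → x ≤ y) → 𝟙 b * x ≤ 𝟙 b * y
𝟙*-monoʳ-≤ false _   = z≤n
𝟙*-monoʳ-≤ true  x≤y = +-monoˡ-≤ 0 (x≤y _)

∑-mono-≤ : {f g : Fin n → ℕ} → (∀ i → f i ≤ g i) → sum f ≤ sum g
∑-mono-≤ {zero}  _   = z≤n
∑-mono-≤ {suc n} f≤g = +-mono-≤ (f≤g zero) (∑-mono-≤ (f≤g ∘ suc))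

_⊆_ : (Fin n → Bool) → (Fin n → Bool) → Set
U ⊆ V = ∀ {u} → T (U u) → T (V u)

⁅_⁆ : Fin n → Fin n → Bool
⁅ v ⁆ u = does (u ≟ v)

∈⁅⁆⇒≡ : (u v : Fin n) → T (⁅ v ⁆ u) → u ≡ v
∈⁅⁆⇒≡ u v u∈⁅v⁆ with u ≟ v
... | yes u≡v = u≡v

⁅⁆⊆ : (V : Fin n → Bool) {v : Fin n} → T (V v) → ⁅ v ⁆ ⊆ V
⁅⁆⊆ V {v} v∈V {u} u∈⁅v⁆ = subst (T ∘ V) (sym (∈⁅⁆⇒≡ u v u∈⁅v⁆)) v∈V

size : (Fin n → Bool) → ℕ
size {n} V = ∑[ u < n ] 𝟙 (V u)

size-split : (V W : Fin n → Bool) →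
             size V ≡ size (λ u → V u ∧ not (W u)) + size (λ u → V u ∧ W u)
size-split V W = trans (sum-cong-≗ (λ u → 𝟙-split (V u) (W u)))
                       (∑-distrib-+ (λ u → 𝟙 (V u ∧ not (W u))) (λ u → 𝟙 (V u ∧ W u)))

size-∪ : {V W : Fin n → Bool} → (∀ u → ¬ (T (V u) × T (W u))) →
         size (λ u → V u ∨ W u) ≡ size V + size W
size-∪ {V = V} {W} disjoint =
  trans (sum-cong-≗ (λ u → 𝟙-∨ (disjoint u))) (∑-distrib-+ (𝟙 ∘ V) (𝟙 ∘ W))

size-mono : {U V : Fin n → Bool} → U ⊆ V → size U ≤ size V
size-mono U⊆V = ∑-mono-≤ (λ u → 𝟙-mono (U⊆V {u}))

size-∅ : {V : Fin n → Bool} → (∀ u → ¬ T (V u)) → size V ≡ 0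
size-∅ {n} {V} empty = trans (sum-cong-≗ 𝟙-false) (sum-replicate-zero n)
  where
  𝟙-false : ∀ u → 𝟙 (V u) ≡ 0
  𝟙-false u with V u | empty u
  ... | false | _       = refl
  ... | true  | u∉V = ⊥-elim (u∉V _)

size-⁅⁆ : (v : Fin n) → size ⁅ v ⁆ ≡ 1
size-⁅⁆ {suc n} zero    = cong suc (sum-replicate-zero n)
size-⁅⁆ {suc n} (suc v) = size-⁅⁆ v

size-⊤ : ∀ n → size {n} (λ _ → true) ≡ n
size-⊤ zero    = refl
size-⊤ (suc n) = cong suc (size-⊤ n)

argmin-on : (f : Fin n → ℕ) {V : Fin n → Bool} {v₀ : Fin n} → T (V v₀) →
            ∃ λ v → T (V v) × (∀ {u} → T (V u) → f v ≤ f u)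
argmin-on {n} f {V} {v₀} v₀∈V =
  argmin f v₀ candidates ,
  argmin-all f v₀∈V (all-filter (T? ∘ V) (allFin n)) ,
  λ u∈V → All-lookup (f[argmin]≤f[xs] v₀ candidates) (∈-filter⁺ (T? ∘ V) (∈-allFin _) u∈V)
  where
  candidates : List (Fin n)
  candidates = filterᵇ V (allFin n)

module Graph {n : ℕ} (adj : Fin n → Fin n → Bool)
             (adj-sym : ∀ u w → adj u w ≡ adj w u)
             (adj-irrefl : ∀ u → ¬ T (adj u u)) where

  degree : (Fin n → Bool) → Fin n → ℕ
  degree V u = size (λ w → V w ∧ adj u w)

  degreeSum : (Fin n → Bool) → ℕ
  degreeSum V = ∑[ u < n ] (𝟙 (V u) * degree V u)

  HasEdge : (Fin n → Bool) → Set
  HasEdge U = ∃₂ λ u w → T (U u) × T (U w) × T (adj u w)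

  NoIndependentSetOfSize : ℕ → (Fin n → Bool) → Set
  NoIndependentSetOfSize k V = ∀ U → U ⊆ V → size U ≡ k → HasEdge U

  degree-mono : ∀ {U V} → U ⊆ V → ∀ u → degree U u ≤ degree V u
  degree-mono {U} {V} U⊆V u = size-mono {U = λ w → U w ∧ adj u w} {V = λ w → V w ∧ adj u w}
    λ w∈U∧adj → let w∈U , adj-uw = T-∧ .to w∈U∧adj in T-∧ .from (U⊆V w∈U , adj-uw)

  ¬HasEdge-⁅⁆ : ∀ v → ¬ HasEdge ⁅ v ⁆
  ¬HasEdge-⁅⁆ v (u , w , u∈ , w∈ , adj-uw) with ∈⁅⁆⇒≡ u v u∈ | ∈⁅⁆⇒≡ w v w∈
  ... | refl | refl = adj-irrefl u adj-uw

  N[_] : Fin n → Fin n → Bool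
  N[ v ] u = ⁅ v ⁆ u ∨ adj v u

  _∖N[_] : (Fin n → Bool) → Fin n → Fin n → Bool
  (V ∖N[ v ]) u = V u ∧ not (N[ v ] u)

  module _ {V : Fin n → Bool} {v : Fin n} (v∈V : T (V v)) where

    size-∩N[] : size (λ u → V u ∧ N[ v ] u) ≡ suc (degree V v)
    size-∩N[] = begin
      size (λ u → V u ∧ N[ v ] u)             ≡⟨ sum-cong-≗ (cong 𝟙 ∘ ∩N[]) ⟩
      size (λ u → ⁅ v ⁆ u ∨ (V u ∧ adj v u))  ≡⟨ size-∪ disjoint ⟩
      size ⁅ v ⁆ + degree V v                 ≡⟨ cong (_+ degree V v) (size-⁅⁆ v) ⟩
      suc (degree V v)                        ∎
      where
      open ≡-Reasoning
      ∩N[] : ∀ u → V u ∧ N[ v ] u ≡ ⁅ v ⁆ u ∨ (V u ∧ adj v u)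
      ∩N[] u with u ≟ v
      ... | yes refl rewrite T-≡ .to v∈V = refl
      ... | no _ = refl
      disjoint : ∀ u → ¬ (T (⁅ v ⁆ u) × T (V u ∧ adj v u))
      disjoint u (u∈⁅v⁆ , u∈V∧adj) with ∈⁅⁆⇒≡ u v u∈⁅v⁆
      ... | refl = adj-irrefl v (proj₂ (T-∧ .to u∈V∧adj))

    size-∖N[] : size V ≡ size (V ∖N[ v ]) + suc (degree V v)
    size-∖N[] = trans (size-split V N[ v ]) (cong (size (V ∖N[ v ]) +_) size-∩N[])

    degreeSum-∖N[] : (∀ {u} → T (V u) → degree V v ≤ degree V u) →
                     degreeSum (V ∖N[ v ]) + suc (degree V v) * degree V v ≤ degreeSum V
    degreeSum-∖N[] minimal = begin
      degreeSum V′ + suc d * d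
        ≡⟨ cong (degreeSum V′ +_) (trans (cong (_* d) (sym size-∩N[])) (*-distribʳ-sum d (𝟙 ∘ R))) ⟩
      ∑[ u < n ] (𝟙 (V′ u) * degree V′ u) + ∑[ u < n ] (𝟙 (R u) * d)
        ≤⟨ +-mono-≤ (∑-mono-≤ λ u → 𝟙*-monoʳ-≤ (V′ u) λ _ → degree-mono V′⊆V u)
                    (∑-mono-≤ λ u → 𝟙*-monoʳ-≤ (R u) (minimal ∘ proj₁ ∘ T-∧ .to)) ⟩
      ∑[ u < n ] (𝟙 (V′ u) * degree V u) + ∑[ u < n ] (𝟙 (R u) * degree V u)
        ≡⟨ ∑-distrib-+ (λ u → 𝟙 (V′ u) * degree V u) (λ u → 𝟙 (R u) * degree V u) ⟨
      ∑[ u < n ] (𝟙 (V′ u) * degree V u + 𝟙 (R u) * degree V u)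
        ≡⟨ sum-cong-≗ (λ u → trans (cong (_* degree V u) (𝟙-split (V u) (N[ v ] u)))
                                   (*-distribʳ-+ (degree V u) (𝟙 (V′ u)) (𝟙 (R u)))) ⟨
      degreeSum V ∎
      where
      open ≤-Reasoning
      V′ R : Fin n → Bool
      V′ = V ∖N[ v ]
      R u = V u ∧ N[ v ] u
      d : ℕ
      d = degree V v
      V′⊆V : V′ ⊆ V
      V′⊆V = proj₁ ∘ T-∧ .to

    noIndependentSet-∖N[] : ∀ {k} → NoIndependentSetOfSize (suc k) V →
                            NoIndependentSetOfSize k (V ∖N[ v ])
    noIndependentSet-∖N[] {k} noIndep U U⊆V′ ∣U∣≡k = edge-of-U⁺⇒edge-of-U (noIndep U⁺ U⁺⊆V ∣U⁺∣≡1+k)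
      where
      U⁺ : Fin n → Bool
      U⁺ u = ⁅ v ⁆ u ∨ U u
      U-avoids-N[v] : ∀ {u} → T (U u) → ¬ T (N[ v ] u)
      U-avoids-N[v] u∈U = T-not⇒¬T (proj₂ (T-∧ .to (U⊆V′ u∈U)))
      U⁺⊆V : U⁺ ⊆ V
      U⁺⊆V {u} u∈U⁺ with T-∨ .to u∈U⁺
      ... | inj₁ u∈⁅v⁆ = ⁅⁆⊆ V v∈V u∈⁅v⁆
      ... | inj₂ u∈U   = proj₁ (T-∧ .to (U⊆V′ u∈U))
      ∣U⁺∣≡1+k : size U⁺ ≡ suc k
      ∣U⁺∣≡1+k = trans (size-∪ {V = ⁅ v ⁆} {U} disjoint) (cong₂ _+_ (size-⁅⁆ v) ∣U∣≡k)
        where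
        disjoint : ∀ u → ¬ (T (⁅ v ⁆ u) × T (U u))
        disjoint u (u∈⁅v⁆ , u∈U) = U-avoids-N[v] u∈U (T-∨ .from (inj₁ u∈⁅v⁆))
      ∈U : ∀ {x y} → T (U⁺ x) → T (U⁺ y) → T (adj x y) → T (U x)
      ∈U {x} {y} x∈U⁺ y∈U⁺ adj-xy with T-∨ .to x∈U⁺ | T-∨ .to y∈U⁺
      ... | inj₂ x∈U   | _ = x∈U
      ... | inj₁ x∈⁅v⁆ | inj₁ y∈⁅v⁆ with ∈⁅⁆⇒≡ x v x∈⁅v⁆ | ∈⁅⁆⇒≡ y v y∈⁅v⁆
      ...   | refl | refl = ⊥-elim (adj-irrefl v adj-xy)
      ∈U {x} {y} x∈U⁺ y∈U⁺ adj-xy | inj₁ x∈⁅v⁆ | inj₂ y∈U with ∈⁅⁆⇒≡ x v x∈⁅v⁆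
      ...   | refl = ⊥-elim (U-avoids-N[v] y∈U (T-∨ .from (inj₂ adj-xy)))
      edge-of-U⁺⇒edge-of-U : HasEdge U⁺ → HasEdge U
      edge-of-U⁺⇒edge-of-U (x , y , x∈U⁺ , y∈U⁺ , adj-xy) =
        x , y , ∈U x∈U⁺ y∈U⁺ adj-xy , ∈U y∈U⁺ x∈U⁺ (subst T (adj-sym x y) adj-xy) , adj-xy

  turán : ∀ a V → NoIndependentSetOfSize (suc a) V → size V * size V ≤ a * (degreeSum V + size V)
  turán a V noIndep with any? (λ u → T? (V u))
  ... | no V-empty =
    subst (λ s → s * s ≤ a * (degreeSum V + s)) (sym (size-∅ (λ u u∈V → V-empty (u , u∈V)))) z≤n
  turán zero V noIndep | yes (v , v∈V) = ⊥-elim (¬HasEdge-⁅⁆ v (noIndep ⁅ v ⁆ (⁅⁆⊆ V v∈V) (size-⁅⁆ v)))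
  turán (suc a) V noIndep | yes (v₀ , v₀∈V) with argmin-on (degree V) v₀∈V
  ... | v , v∈V , minimal = begin
    size V * size V                  ≡⟨ cong (λ s → s * s) (size-∖N[] v∈V) ⟩
    (x + suc d) * (x + suc d)        ≤⟨ x²≤a*w⇒[x+y]²≤[1+a]*[w+y²] a x (suc d) (D′ + x) induction ⟩
    suc a * (D′ + x + suc d * suc d) ≤⟨ *-monoʳ-≤ (suc a) removed ⟩
    suc a * (degreeSum V + size V)   ∎
    where
    open ≤-Reasoning
    V′ : Fin n → Bool
    V′ = V ∖N[ v ]
    x d D′ : ℕ
    x = size V′
    d = degree V v
    D′ = degreeSum V′
    induction : x * x ≤ a * (D′ + x)
    induction = turán a V′ (noIndependentSet-∖N[] v∈V noIndep)
    removed : D′ + x + suc d * suc d ≤ degreeSum V + size V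
    removed = begin
      D′ + x + suc d * suc d          ≡⟨ regroup D′ x d ⟩
      D′ + suc d * d + (x + suc d)    ≤⟨ +-mono-≤ (degreeSum-∖N[] v∈V minimal) (≤-reflexive (sym (size-∖N[] v∈V))) ⟩
      degreeSum V + size V            ∎
      where
      regroup : ∀ D x d → D + x + suc d * suc d ≡ D + suc d * d + (x + suc d)
      regroup = solve-∀

module SymmetricClosure {n : ℕ} (E : Fin n → Fin n → Bool)
                        (E-asym : ∀ u w → T (E u w) → ¬ T (E w u)) where

  adj : Fin n → Fin n → Bool
  adj u w = E u w ∨ E w u

  adj-irrefl : ∀ u → ¬ T (adj u u)
  adj-irrefl u Euu∨Euu = [ irrefl , irrefl ]′ (T-∨ .to Euu∨Euu)
    where
    irrefl : ¬ T (E u u)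
    irrefl Euu = E-asym u u Euu Euu

  open Graph adj (λ u w → ∨-comm (E u w) (E w u)) adj-irrefl public

  degreeSum-⊤ : degreeSum (λ _ → true) ≡ 2 * ∑[ u < n ] ∑[ w < n ] 𝟙 (E u w)
  degreeSum-⊤ = begin
    ∑[ u < n ] (1 * degree (λ _ → true) u)
      ≡⟨ sum-cong-≗ (λ u → *-identityˡ (degree (λ _ → true) u)) ⟩
    ∑[ u < n ] size (adj u)
      ≡⟨ sum-cong-≗ (λ u → size-∪ {V = E u} {W = λ w → E w u} (λ w (uw , wu) → E-asym u w uw wu)) ⟩
    ∑[ u < n ] (∑[ w < n ] 𝟙 (E u w) + ∑[ w < n ] 𝟙 (E w u))
      ≡⟨ ∑-distrib-+ (λ u → ∑[ w < n ] 𝟙 (E u w)) (λ u → ∑[ w < n ] 𝟙 (E w u)) ⟩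
    X + ∑[ u < n ] ∑[ w < n ] 𝟙 (E w u)
      ≡⟨ cong (X +_) (∑-comm (λ u w → 𝟙 (E w u))) ⟩
    X + X
      ≡⟨ cong (X +_) (+-identityʳ X) ⟨
    2 * X ∎
    where
    open ≡-Reasoning
    X : ℕ
    X = ∑[ u < n ] ∑[ w < n ] 𝟙 (E u w)

∈-filterᵇ⁻ : ∀ (p : A → Bool) {xs x} → x ∈ filterᵇ p xs → x ∈ xs × T (p x)
∈-filterᵇ⁻ p = ∈-filter⁻ (T? ∘ p)

length-filterᵇ-++ : ∀ (p : A → Bool) xs ys →
                    length (filterᵇ p (xs ++ ys)) ≡ length (filterᵇ p xs) + length (filterᵇ p ys)
length-filterᵇ-++ p xs ys = trans (cong length (filter-++ (T? ∘ p) xs ys)) (length-++ (filterᵇ p xs))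

length-filterᵇ-concatMap : (p : B → Bool) (h : A → List B) (f : Fin n → A) →
  length (filterᵇ p (concatMap h (tabulate f))) ≡ ∑[ i < n ] length (filterᵇ p (h (f i)))
length-filterᵇ-concatMap {n = zero}  p h f = refl
length-filterᵇ-concatMap {n = suc n} p h f =
  trans (length-filterᵇ-++ p (h (f zero)) _)
        (cong (length (filterᵇ p (h (f zero))) +_) (length-filterᵇ-concatMap p h (f ∘ suc)))

length-filterᵇ-if : ∀ (p : A → Bool) b x → length (filterᵇ p (if b then [ x ] else [])) ≡ 𝟙 (b ∧ p x)
length-filterᵇ-if p false x = refl
length-filterᵇ-if p true  x with p x
... | true  = refl
... | false = refl

∈-allSubsets : (s : Subset.Subset n) → s ∈ allSubsets n
∈-allSubsets Vec.[]            = here refl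
∈-allSubsets (true  Vec.∷ s) = ∈-++⁺ˡ (∈-map⁺ (true Vec.∷_) (∈-allSubsets s))
∈-allSubsets (false Vec.∷ s) = ∈-++⁺ʳ (map (true Vec.∷_) (allSubsets _)) (∈-map⁺ (false Vec.∷_) (∈-allSubsets s))

∣tabulate∣≡size : (U : Fin n → Bool) → Subset.∣ Vec.tabulate U ∣ ≡ size U
∣tabulate∣≡size {zero}  U = refl
∣tabulate∣≡size {suc n} U with U zero
... | true  = cong suc (∣tabulate∣≡size (U ∘ suc))
... | false = ∣tabulate∣≡size (U ∘ suc)

tabulate∈kSubsets : ∀ {k} (U : Fin n → Bool) → size U ≡ k → Vec.tabulate U ∈ kSubsets n k
tabulate∈kSubsets {k = k} U ∣U∣≡k =
  ∈-filter⁺ (T? ∘ λ s → Subset.∣ s ∣ ≡ᵇ k) (∈-allSubsets _) (≡⇒≡ᵇ _ _ (trans (∣tabulate∣≡size U) ∣U∣≡k))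

choices-meets : ∀ {xss : List (List A)} {g xs} → g ∈ choices xss → xs ∈ xss → ∃ λ x → x ∈ g × x ∈ xs
choices-meets {xss = ys ∷ yss} g∈ xs∈ with find (∈-concatMap⁻ (λ y → map (y ∷_) (choices yss)) {xs = ys} g∈)
... | y , y∈ys , g∈y∷ with ∈-map⁻ (y ∷_) g∈y∷
...   | g′ , g′∈ , refl with xs∈
...     | here refl = y , here refl , y∈ys
...     | there xs∈yss with choices-meets g′∈ xs∈yss
...       | x , x∈g′ , x∈xs = x , there x∈g′ , x∈xs

∈-sublists⁻ : ∀ (L : List A) {G x} → G ∈ sublists L → x ∈ G → x ∈ L
∈-sublists⁻ []       (here refl) ()
∈-sublists⁻ (y ∷ ys) G∈ x∈G with ∈-++⁻ (map (y ∷_) (sublists ys)) G∈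
... | inj₂ G∈′ = there (∈-sublists⁻ ys G∈′ x∈G)
... | inj₁ G∈y∷ with ∈-map⁻ (y ∷_) G∈y∷
...   | G′ , G′∈ , refl with x∈G
...     | here refl = here refl
...     | there x∈G′ = there (∈-sublists⁻ ys G′∈ x∈G′)

graphsOn-edge : ∀ {S : Subset.Subset n} {G} → G ∈ graphsOn S → ∃ λ e → e ∈ G × e ∈ edgesIn S
graphsOn-edge {n} {S} {G} G∈ = nonempty G (∈-filterᵇ⁻ proper G∈)
  where
  proper : List (Edge n) → Bool
  proper G = not (null G) ∧ not (length G ≡ᵇ length (edgesIn S))
  nonempty : ∀ G → G ∈ sublists (edgesIn S) × T (proper G) → ∃ λ e → e ∈ G × e ∈ edgesIn S
  nonempty []      (_ , ())
  nonempty (e ∷ _) (G∈ , _) = e , here refl , ∈-sublists⁻ (edgesIn S) G∈ (here refl)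

∈-allEdges⁻ : ∀ {i j : Fin n} → (i , j) ∈ allEdges n → T (toℕ i <ᵇ toℕ j)
∈-allEdges⁻ {n} {i} {j} ij∈ =
  let i′ , _ , ij∈row   = find (∈-concatMap⁻ row {xs = allFin n} ij∈)
      j′ , _ , ij∈entry = find (∈-concatMap⁻ (entry i′) {xs = allFin n} ij∈row)
  in ∈entry⁻ ij∈entry
  where
  entry : Fin n → Fin n → List (Edge n)
  entry i′ j′ = if toℕ i′ <ᵇ toℕ j′ then [ (i′ , j′) ] else []
  row : Fin n → List (Edge n)
  row i′ = concatMap (entry i′) (allFin n)
  ∈entry⁻ : ∀ {i′ j′} → (i , j) ∈ entry i′ j′ → T (toℕ i <ᵇ toℕ j)
  ∈entry⁻ {i′} {j′} ij∈ with toℕ i′ <ᵇ toℕ j′ in i′<j′ | ij∈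
  ... | true | here refl = T-≡ .from i′<j′

∈-edgesIn⁻ : ∀ {S : Subset.Subset n} {i j} → (i , j) ∈ edgesIn S →
             T (Vec.lookup S i) × T (Vec.lookup S j) × T (toℕ i <ᵇ toℕ j)
∈-edgesIn⁻ ij∈ with ∈-filterᵇ⁻ _ ij∈
... | ij∈all , i∈S∧j∈S = let i∈S , j∈S = T-∧ .to i∈S∧j∈S in i∈S , j∈S , ∈-allEdges⁻ ij∈all

edgeEqᵇ-refl : (e : Edge n) → T (edgeEqᵇ e e)
edgeEqᵇ-refl (i , j) = T-∧ .from (≡⇒≡ᵇ (toℕ i) _ refl , ≡⇒≡ᵇ (toℕ j) _ refl)

module AssignmentGraph {n : ℕ} (g : Assignment n) where

  isEdge : Edge n → Bool
  isEdge e = any (λ G → any (edgeEqᵇ e) G) g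

  -- Pairs are listed as (i , j) with i < j; keeping that test here lets numEdges be read
  -- off as a double sum over Fin n without proving that isEdge holds only on such pairs.
  oriented : Fin n → Fin n → Bool
  oriented i j = (toℕ i <ᵇ toℕ j) ∧ isEdge (i , j)

  oriented-asym : ∀ i j → T (oriented i j) → ¬ T (oriented j i)
  oriented-asym i j ij ji =
    <-asym (<ᵇ⇒< (toℕ i) (toℕ j) (proj₁ (T-∧ .to ij))) (<ᵇ⇒< (toℕ j) (toℕ i) (proj₁ (T-∧ .to ji)))

  open SymmetricClosure oriented oriented-asym

  numEdges≡ : numEdges g ≡ ∑[ i < n ] ∑[ j < n ] 𝟙 (oriented i j)
  numEdges≡ = trans (length-filterᵇ-concatMap isEdge (λ i → concatMap (pair i) (allFin n)) id) $
              sum-cong-≗ λ i → trans (length-filterᵇ-concatMap isEdge (pair i) id) $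
              sum-cong-≗ λ j → length-filterᵇ-if isEdge (toℕ i <ᵇ toℕ j) (i , j)
    where
    pair : Fin n → Fin n → List (Edge n)
    pair i j = if toℕ i <ᵇ toℕ j then [ (i , j) ] else []

  isEdge-intro : ∀ {G e} → G ∈ g → e ∈ G → T (isEdge e)
  isEdge-intro {e = e} G∈g e∈G = any⁺ _ (lose G∈g (any⁺ _ (lose e∈G (edgeEqᵇ-refl e))))

  noIndependentSet : ∀ {k} → g ∈ assignments n k → NoIndependentSetOfSize k (λ _ → true)
  noIndependentSet g∈ U _ ∣U∣≡k
    with choices-meets g∈ (∈-map⁺ graphsOn (tabulate∈kSubsets U ∣U∣≡k))
  ... | G , G∈g , G∈graphsOn with graphsOn-edge {S = Vec.tabulate U} G∈graphsOn
  ...   | (i , j) , ij∈G , ij∈edgesIn with ∈-edgesIn⁻ {S = Vec.tabulate U} ij∈edgesIn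
  ...     | i∈S , j∈S , i<j =
    i , j , subst T (lookup∘tabulate U i) i∈S , subst T (lookup∘tabulate U j) j∈S ,
    T-∨ .from (inj₁ (T-∧ .from (i<j , isEdge-intro G∈g ij∈G)))

  numEdges-bound : ∀ {a} → g ∈ assignments n (suc a) → n * n ≤ a * (2 * numEdges g + n)
  numEdges-bound {a} g∈ =
    subst₂ (λ s D → s * s ≤ a * (D + s)) (size-⊤ n) (trans degreeSum-⊤ (cong (2 *_) (sym numEdges≡)))
           (turán a (λ _ → true) (noIndependentSet g∈))

sumℤ-map-zero : ∀ (f : A → ℤ) xs → (∀ {x} → x ∈ xs → f x ≡ 0ℤ) → sumℤ (map f xs) ≡ 0ℤ
sumℤ-map-zero f []       _      = refl
sumℤ-map-zero f (x ∷ xs) f≡0 rewrite f≡0 (here refl) | sumℤ-map-zero f xs (f≡0 ∘ there) = refl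

proposition5p4 : (n k m : ℕ) → 2 ≤ k → k ≤ n →
    2 * (k ∸ 1) * m + n * (k ∸ 1) < n * n → coeffP n k m ≡ 0ℤ
proposition5p4 n (suc a) m _ _ m-small = sumℤ-map-zero _ (assignments n (suc a)) term
  where
  term : ∀ {g} → g ∈ assignments n (suc a) → (if numEdges g ≡ᵇ m then sign g else 0ℤ) ≡ 0ℤ
  term {g} g∈ with numEdges g ≡ᵇ m in edges≡m
  ... | false = refl
  ... | true  = contradiction (subst (n * n ≤_) bound≡ (AssignmentGraph.numEdges-bound g g∈)) (<⇒≱ m-small)
    where
    bound≡ : a * (2 * numEdges g + n) ≡ 2 * a * m + n * a
    bound≡ rewrite ≡ᵇ⇒≡ (numEdges g) m (T-≡ .from edges≡m) = solve (a ∷ m ∷ n ∷ [])
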